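{- For the problem of minimizing makespan for online job scheduling on $m \ge 2$ identical machines, $\textsc{Greedy}$ has online bounded ratio at most $2-\frac{1}{m-1}$.
   Context: Jobs with positive sizes arrive online and each must be assigned irrevocably (without preemption) to one of $m$ identical machines; the load of a machine is the total size of jobs assigned to it, and the makespan is the maximum load; the goal is to minimize the makespan. $\textsc{Greedy}$ assigns each job to a currently least loaded machine (ties arbitrary). For a deterministic online algorithm $A$ of a minimization problem, $\textsc{Opt}_A$ denotes an offline algorithm that is optimal among offline algorithms whose solution on any input $I$ satisfies, for every prefix $I'$ of $I$, that the cost of the solution restricted to $I'$ is at most $A(I')$. The online bounded ratio of $A$ is the infimum of all constants $c$ such that $A(I) \le c\,\textsc{Opt}_A(I)$ for all inputs $I$.
   Formalization: The job sizes are positive rationals. -}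

module Defs where

open import Data.Nat using (ℕ; zero; suc)
open import Data.Fin using (Fin; _≟_)
open import Data.List using (List; []; _∷_; _++_; [_]; foldr; zip; take; length)
open import Data.List.Relation.Unary.All using (All)
open import Data.Product using (_×_; _,_)
open import Data.Integer using (+_)
open import Data.Rational using (ℚ; 0ℚ; _+_; _-_; _*_; _⊔_; _<_; _≤_; _/_)
open import Relation.Nullary using (yes; no)
open import Data.List using (allFin)
open import Relation.Binary.PropositionalEquality using (_≡_)

Schedule : ℕ → Set
Schedule m = List (ℚ × Fin m)

load : ∀ {m} → Schedule m → Fin m → ℚ
load [] j = 0ℚ
load ((x , i) ∷ s) j with i ≟ j
... | yes _ = x + load s j
... | no  _ = load s j

-- makespan: maximum load over all m machines (loads are ≥ 0, so 0 is a neutral start)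
makespan : ∀ {m} → Schedule m → ℚ
makespan {m} s = foldr (λ j acc → load s j ⊔ acc) 0ℚ (allFin m)

-- A deterministic online algorithm on m machines: given the previously released
-- jobs (in order) and the size of the current job, it chooses a machine.
-- (Being deterministic, its earlier decisions are determined by the earlier jobs.)
OnlineAlg : ℕ → Set
OnlineAlg m = List ℚ → ℚ → Fin m

runFrom : ∀ {m} → OnlineAlg m → List ℚ → List ℚ → Schedule m
runFrom A hist [] = []
runFrom A hist (x ∷ xs) = (x , A hist x) ∷ runFrom A (hist ++ [ x ]) xs

run : ∀ {m} → OnlineAlg m → List ℚ → Schedule m
run A I = runFrom A [] I

cost : ∀ {m} → OnlineAlg m → List ℚ → ℚ
cost A I = makespan (run A I)

IsGreedy : ∀ {m} → OnlineAlg m → Set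
IsGreedy {m} A = ∀ (hist : List ℚ) (x : ℚ) (j : Fin m) →
  load (run A hist) (A hist x) ≤ load (run A hist) j

assign : ∀ {m} → List ℚ → List (Fin m) → Schedule m
assign I σ = zip I σ

-- The feasibility constraint defining Opt_A: for every prefix I' of I, the cost of
-- the solution restricted to I' is at most A(I').
RespectsPrefixes : ∀ {m} → OnlineAlg m → List ℚ → List (Fin m) → Set
RespectsPrefixes A I σ =
  ∀ (k : ℕ) → makespan (assign (take k I) (take k σ)) ≤ cost A (take k I)

-- Opt_A(I) is the minimum cost over such solutions; hence
-- "A(I) ≤ c · Opt_A(I)" says exactly that A(I) ≤ c · cost(σ) for every
-- solution σ of I respecting the prefix constraint.
BoundedBy : ∀ {m} → OnlineAlg m → ℚ → List ℚ → Set
BoundedBy {m} A c I =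
  ∀ (σ : List (Fin m)) → length σ ≡ length I → RespectsPrefixes A I σ →
  cost A I ≤ c * makespan (assign I σ)

-- The constant 2 - 1/(m-1), for m ≥ 2 (value for m < 2 is irrelevant).
greedyBound : ℕ → ℚ
greedyBound (suc (suc k)) = (+ 2 / 1) - (+ 1 / suc k)
greedyBound _ = 0ℚ

{-# OPTIONS --safe #-}
-- Greedy puts the last job x on a least loaded machine, of load L;
-- its other machines are bounded by induction, since appending x to the competing schedule σ
-- does not decrease its makespan a. Before x, Greedy's total load is at least M + (m - 1) L,
-- M its makespan, and by the prefix constraint every machine of σ carries at most M. After
-- x, a machine of σ other than x's still carries at most M and the remaining m - 1 at most a,
-- so comparing totals, M + (m - 1) L + x ≤ M + (m - 1) a. As x ≤ a, L + x ≤ (2 - 1/(m-1)) a.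

module Submission where

open import Defs
open import Data.Nat using (ℕ; _≤_)
open import Data.List using (List)
open import Data.List.Relation.Unary.All using (All)
open import Data.Rational using (ℚ; 0ℚ; _<_)

open import Algebra.Bundles using (Ring)
open import Data.Fin using (Fin; zero; suc; _≟_; punchIn)
open import Data.Fin.Properties using (punchInᵢ≢i)
import Data.Integer as ℤ
import Data.Integer.Properties as ℤP
open import Data.List
  using ([]; _∷_; tabulate; _++_; [_]; _∷ʳ_; foldr; map; zip; take; length; allFin)
open import Data.List.Membership.Propositional using (_∈_)
open import Data.List.Membership.Propositional.Properties using (∈-allFin)
open import Data.List.Properties
  using (length-++-sucʳ; take-all; ∷-injective; ++-identityʳ; ++-assoc)
open import Data.List.Relation.Unary.All as All using ([]; _∷_)
open import Data.List.Relation.Unary.All.Properties using (tabulate⁺; ++⁻ˡ; ++⁻ʳ)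
open import Data.List.Relation.Unary.Any using (here; there)
open import Data.List.Reverse using (Reverse; reverseView; []; _∶_∶ʳ_)
open import Data.Nat using (zero; suc; _⊓_; s≤s; z≤n)
open import Data.Nat.Coprimality using (1-coprimeTo) renaming (sym to coprime-sym)
import Data.Nat.Properties as ℕP
open import Data.Product using (∃-syntax; _,_; proj₁; proj₂)
import Data.Rational as ℚ
open import Data.Rational using (1ℚ; mkℚ; _+_; _*_; _-_; _/_; _⊔_; -_; *≤*)
import Data.Rational.Properties as ℚP
open import Data.Rational.Solver using (module +-*-Solver)
open import Data.Sum using (inj₁; inj₂)
open import Data.Vec.Functional using (Vector; removeAt)
open import Function using (_∘_)
open import Relation.Binary.PropositionalEquality
  using (_≡_; _≢_; _≗_; refl; sym; trans; cong; cong₂; subst; subst₂)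
open import Relation.Nullary using (yes; no; contradiction)
open import Algebra.Properties.CommutativeMonoid.Sum ℚP.+-0-commutativeMonoid
  using (sum; sum-remove; sum-cong-≗; sum-replicate)
open import Algebra.Properties.Semiring.Mult (Ring.semiring ℚP.+-*-ring)
  using (_×_; ×-assoc-*)

open +-*-Solver using (solve; _:=_; _:+_; _:*_; _:-_; :-_; con)
open ℚP.≤-Reasoning

+-cancelˡ-≤ : ∀ r {p q} → r + p ℚ.≤ r + q → p ℚ.≤ q
+-cancelˡ-≤ r {p} {q} r+p≤r+q = begin
  p                ≡⟨ sym (cancel r p) ⟩
  - r + (r + p)    ≤⟨ ℚP.+-monoʳ-≤ (- r) r+p≤r+q ⟩
  - r + (r + q)    ≡⟨ cancel r q ⟩
  q                ∎
  where
  cancel : ∀ r p → - r + (r + p) ≡ p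
  cancel = solve 2 (λ r p → :- r :+ (r :+ p) := p) refl

p≤q⇒0≤q-p : ∀ {p q} → p ℚ.≤ q → 0ℚ ℚ.≤ q - p
p≤q⇒0≤q-p {p} {q} p≤q = begin
  0ℚ     ≡⟨ sym (ℚP.+-inverseʳ p) ⟩
  p - p  ≤⟨ ℚP.+-monoˡ-≤ (- p) p≤q ⟩
  q - p  ∎

q≤p+q : ∀ {p} q → 0ℚ ℚ.≤ p → q ℚ.≤ p + q
q≤p+q {p} q 0≤p = subst (ℚ._≤ p + q) (ℚP.+-identityˡ q) (ℚP.+-monoˡ-≤ q 0≤p)

maxOver : {A : Set} → (A → ℚ) → List A → ℚ
maxOver f = foldr (λ a acc → f a ⊔ acc) 0ℚ

module _ {A : Set} (f : A → ℚ) where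

  0≤maxOver : ∀ as → 0ℚ ℚ.≤ maxOver f as
  0≤maxOver []       = ℚP.≤-refl
  0≤maxOver (a ∷ as) = ℚP.≤-trans (0≤maxOver as) (ℚP.p≤q⊔p (f a) _)

  ∈⇒≤maxOver : ∀ {a as} → a ∈ as → f a ℚ.≤ maxOver f as
  ∈⇒≤maxOver (here refl) = ℚP.p≤p⊔q _ _
  ∈⇒≤maxOver {as = b ∷ _} (there a∈as) = ℚP.≤-trans (∈⇒≤maxOver a∈as) (ℚP.p≤q⊔p (f b) _)

  maxOver-lub : ∀ {b as} → 0ℚ ℚ.≤ b → All (λ a → f a ℚ.≤ b) as → maxOver f as ℚ.≤ b
  maxOver-lub 0≤b []           = 0≤b
  maxOver-lub 0≤b (fa≤b ∷ all) = ℚP.⊔-lub fa≤b (maxOver-lub 0≤b all)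

  maxOver-attained : (∀ a → 0ℚ ℚ.≤ f a) → ∀ a as → ∃[ b ] maxOver f (a ∷ as) ℚ.≤ f b
  maxOver-attained f≥0 a [] = a , ℚP.⊔-lub ℚP.≤-refl (f≥0 a)
  maxOver-attained f≥0 a (b ∷ bs) with maxOver-attained f≥0 b bs
  ... | c , max≤fc with ℚP.≤-total (f a) (f c)
  ...   | inj₁ fa≤fc = c , ℚP.⊔-lub fa≤fc max≤fc
  ...   | inj₂ fc≤fa = a , ℚP.⊔-lub ℚP.≤-refl (ℚP.≤-trans max≤fc fc≤fa)

maxOver-cong : ∀ {A : Set} {f g : A → ℚ} → f ≗ g → ∀ as → maxOver f as ≡ maxOver g as
maxOver-cong f≗g []       = refl
maxOver-cong f≗g (a ∷ as) = cong₂ _⊔_ (f≗g a) (maxOver-cong f≗g as)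

sizes : ∀ {m} → Schedule m → List ℚ
sizes = map proj₁

module _ {m : ℕ} where

  0≤makespan : (s : Schedule m) → 0ℚ ℚ.≤ makespan s
  0≤makespan s = 0≤maxOver (load s) (allFin m)

  load≤makespan : (s : Schedule m) (j : Fin m) → load s j ℚ.≤ makespan s
  load≤makespan s j = ∈⇒≤maxOver (load s) (∈-allFin j)

  makespan-lub : ∀ (s : Schedule m) {b} → 0ℚ ℚ.≤ b → (∀ j → load s j ℚ.≤ b) → makespan s ℚ.≤ b
  makespan-lub s 0≤b s≤b = maxOver-lub (load s) 0≤b (tabulate⁺ s≤b)

  load-here : ∀ x (i : Fin m) s → load ((x , i) ∷ s) i ≡ x + load s i
  load-here x i s with i ≟ i
  ... | yes _   = refl
  ... | no i≢i = contradiction refl i≢i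

  load-there : ∀ x {i j : Fin m} s → i ≢ j → load ((x , i) ∷ s) j ≡ load s j
  load-there x {i} {j} s i≢j with i ≟ j
  ... | yes i≡j = contradiction i≡j i≢j
  ... | no _    = refl

  load-++ : ∀ (s t : Schedule m) j → load (s ++ t) j ≡ load s j + load t j
  load-++ [] t j = sym (ℚP.+-identityˡ _)
  load-++ ((x , i) ∷ s) t j with i ≟ j
  ... | yes _ = trans (cong (x +_) (load-++ s t j)) (sym (ℚP.+-assoc x _ _))
  ... | no _  = load-++ s t j

  load-∷ʳ : ∀ (s : Schedule m) p → load (s ∷ʳ p) ≗ load (p ∷ s)
  load-∷ʳ s p j = begin-equality
    load (s ∷ʳ p) j            ≡⟨ load-++ s [ p ] j ⟩
    load s j + load [ p ] j    ≡⟨ ℚP.+-comm (load s j) _ ⟩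
    load [ p ] j + load s j    ≡⟨ sym (load-++ [ p ] s j) ⟩
    load (p ∷ s) j             ∎

  makespan-∷ʳ : ∀ (s : Schedule m) p → makespan (s ∷ʳ p) ≡ makespan (p ∷ s)
  makespan-∷ʳ s p = maxOver-cong (load-∷ʳ s p) (allFin m)

  0≤load : ∀ (s : Schedule m) → All (0ℚ ℚ.≤_) (sizes s) → ∀ j → 0ℚ ℚ.≤ load s j
  0≤load [] _ j = ℚP.≤-refl
  0≤load ((x , i) ∷ s) (0≤x ∷ 0≤s) j with i ≟ j
  ... | yes _ = ℚP.+-mono-≤ 0≤x (0≤load s 0≤s j)
  ... | no _  = 0≤load s 0≤s j

  load≤load-∷ : ∀ {x} (i : Fin m) s → 0ℚ ℚ.≤ x → ∀ j → load s j ℚ.≤ load ((x , i) ∷ s) j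
  load≤load-∷ i s 0≤x j with i ≟ j
  ... | yes _ = q≤p+q (load s j) 0≤x
  ... | no _  = ℚP.≤-refl

  makespan-∷-≤ : ∀ {x b} (i : Fin m) s → makespan s ℚ.≤ b → load s i + x ℚ.≤ b →
                 makespan ((x , i) ∷ s) ℚ.≤ b
  makespan-∷-≤ {x} {b} i s s≤b load+x≤b =
    makespan-lub ((x , i) ∷ s) (ℚP.≤-trans (0≤makespan s) s≤b) bound
    where
    bound : ∀ j → load ((x , i) ∷ s) j ℚ.≤ b
    bound j with i ≟ j
    ... | yes refl = subst (ℚ._≤ b) (ℚP.+-comm (load s i) x) load+x≤b
    ... | no _     = ℚP.≤-trans (load≤makespan s j) s≤b

  makespan≤makespan-∷ : ∀ {x} (i : Fin m) s → 0ℚ ℚ.≤ x → makespan s ℚ.≤ makespan ((x , i) ∷ s)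
  makespan≤makespan-∷ {x} i s 0≤x = makespan-lub s (0≤makespan ((x , i) ∷ s))
    (λ j → ℚP.≤-trans (load≤load-∷ i s 0≤x j) (load≤makespan ((x , i) ∷ s) j))

  size≤makespan-∷ : ∀ x (i : Fin m) s → 0ℚ ℚ.≤ load s i → x ℚ.≤ makespan ((x , i) ∷ s)
  size≤makespan-∷ x i s 0≤load = begin
    x                     ≤⟨ q≤p+q x 0≤load ⟩
    load s i + x          ≡⟨ ℚP.+-comm (load s i) x ⟩
    x + load s i          ≡⟨ sym (load-here x i s) ⟩
    load ((x , i) ∷ s) i  ≤⟨ load≤makespan ((x , i) ∷ s) i ⟩
    makespan ((x , i) ∷ s) ∎

makespan-attained : ∀ {n} (s : Schedule (suc n)) → (∀ j → 0ℚ ℚ.≤ load s j) →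
                    ∃[ j ] makespan s ℚ.≤ load s j
makespan-attained s s≥0 = maxOver-attained (load s) s≥0 zero (tabulate suc)

sum-mono-≤ : ∀ {n} {f g : Vector ℚ n} → (∀ i → f i ℚ.≤ g i) → sum f ℚ.≤ sum g
sum-mono-≤ {zero}  f≤g = ℚP.≤-refl
sum-mono-≤ {suc n} f≤g = ℚP.+-mono-≤ (f≤g zero) (sum-mono-≤ (f≤g ∘ suc))

sum≤n×b : ∀ {n} {f : Vector ℚ n} {b} → (∀ i → f i ℚ.≤ b) → sum f ℚ.≤ n × b
sum≤n×b {n} f≤b = subst (_ ℚ.≤_) (sum-replicate n) (sum-mono-≤ f≤b)

n×b≤sum : ∀ {n} {f : Vector ℚ n} {b} → (∀ i → b ℚ.≤ f i) → n × b ℚ.≤ sum f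
n×b≤sum {n} b≤f = subst (ℚ._≤ _) (sum-replicate n) (sum-mono-≤ b≤f)

module _ {n : ℕ} (f : Vector ℚ (suc n)) (i : Fin (suc n)) {b : ℚ} where

  sum≤f[i]+n×b : (∀ j → f j ℚ.≤ b) → sum f ℚ.≤ f i + n × b
  sum≤f[i]+n×b f≤b = begin
    sum f                    ≡⟨ sum-remove f ⟩
    f i + sum (removeAt f i) ≤⟨ ℚP.+-monoʳ-≤ (f i) (sum≤n×b (f≤b ∘ punchIn i)) ⟩
    f i + n × b              ∎

  f[i]+n×b≤sum : (∀ j → b ℚ.≤ f j) → f i + n × b ℚ.≤ sum f
  f[i]+n×b≤sum b≤f = begin
    f i + n × b              ≤⟨ ℚP.+-monoʳ-≤ (f i) (n×b≤sum (b≤f ∘ punchIn i)) ⟩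
    f i + sum (removeAt f i) ≡⟨ sum-remove f ⟨
    sum f                    ∎

module _ {n : ℕ} where

  sum-load-∷ : ∀ x (i : Fin (suc n)) s → sum (load ((x , i) ∷ s)) ≡ x + sum (load s)
  sum-load-∷ x i s = begin-equality
    sum (load s′)                               ≡⟨ sum-remove {i = i} (load s′) ⟩
    load s′ i + sum (removeAt (load s′) i)      ≡⟨ cong₂ _+_ (load-here x i s) (sum-cong-≗ others) ⟩
    (x + load s i) + sum (removeAt (load s) i)  ≡⟨ ℚP.+-assoc x _ _ ⟩
    x + (load s i + sum (removeAt (load s) i))  ≡⟨ cong (x +_) (sum-remove {i = i} (load s)) ⟨
    x + sum (load s)                            ∎
    where
    s′ : Schedule (suc n)
    s′ = (x , i) ∷ s
    others : removeAt (load s′) i ≗ removeAt (load s) i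
    others j = load-there x s (punchInᵢ≢i i j ∘ sym)

  sum-load-cong : ∀ (s t : Schedule (suc n)) → sizes s ≡ sizes t → sum (load s) ≡ sum (load t)
  sum-load-cong [] [] _ = refl
  sum-load-cong ((x , i) ∷ s) ((y , j) ∷ t) eq with ∷-injective eq
  ... | refl , eq′ = begin-equality
    sum (load ((x , i) ∷ s))  ≡⟨ sum-load-∷ x i s ⟩
    x + sum (load s)          ≡⟨ cong (x +_) (sum-load-cong s t eq′) ⟩
    x + sum (load t)          ≡⟨ sum-load-∷ x j t ⟨
    sum (load ((x , j) ∷ t))  ∎

module _ {N q : ℚ} (Nq≡1 : N * q ≡ 1ℚ) (0≤q : 0ℚ ℚ.≤ q) (q≤1 : q ℚ.≤ 1ℚ) where

  private
    q[N*y]≡y : ∀ y → q * (N * y) ≡ y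
    q[N*y]≡y y = begin-equality
      q * (N * y)  ≡⟨ solve 3 (λ q N y → q :* (N :* y) := (N :* q) :* y) refl q N y ⟩
      (N * q) * y  ≡⟨ cong (_* y) Nq≡1 ⟩
      1ℚ * y       ≡⟨ ℚP.*-identityˡ y ⟩
      y            ∎

  NL+x≤Na⇒L+x≤[2-q]a : ∀ {L x a} → N * L + x ℚ.≤ N * a → x ℚ.≤ a → L + x ℚ.≤ (ℤ.+ 2 / 1 - q) * a
  NL+x≤Na⇒L+x≤[2-q]a {L} {x} {a} NL+x≤Na x≤a = begin
    L + x                           ≡⟨ cong (_+ x) (q[N*y]≡y L) ⟨
    q * (N * L) + x                 ≡⟨ split q (N * L) x ⟩
    q * (N * L + x) + (1ℚ - q) * x  ≤⟨ ℚP.+-mono-≤ (q*-mono NL+x≤Na) ([1-q]*-mono x≤a) ⟩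
    q * (N * a) + (1ℚ - q) * a      ≡⟨ cong (_+ (1ℚ - q) * a) (q[N*y]≡y a) ⟩
    a + (1ℚ - q) * a                ≡⟨ merge q a ⟩
    (ℤ.+ 2 / 1 - q) * a             ∎
    where
    split : ∀ q z x → q * z + x ≡ q * (z + x) + (1ℚ - q) * x
    split = solve 3 (λ q z x → q :* z :+ x := q :* (z :+ x) :+ (con 1ℚ :- q) :* x) refl
    merge : ∀ q a → a + (1ℚ - q) * a ≡ (ℤ.+ 2 / 1 - q) * a
    merge = solve 2 (λ q a → a :+ (con 1ℚ :- q) :* a := (con (ℤ.+ 2 / 1) :- q) :* a) refl
    q*-mono : ∀ {u v} → u ℚ.≤ v → q * u ℚ.≤ q * v
    q*-mono = ℚP.*-monoˡ-≤-nonNeg q {{ℚ.nonNegative 0≤q}}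
    [1-q]*-mono : ∀ {u v} → u ℚ.≤ v → (1ℚ - q) * u ℚ.≤ (1ℚ - q) * v
    [1-q]*-mono = ℚP.*-monoˡ-≤-nonNeg (1ℚ - q) {{ℚ.nonNegative (p≤q⇒0≤q-p q≤1)}}

  0≤2-q : 0ℚ ℚ.≤ ℤ.+ 2 / 1 - q
  0≤2-q = ℚP.≤-trans (p≤q⇒0≤q-p q≤1) (ℚP.+-monoˡ-≤ (- q) {1ℚ} {ℤ.+ 2 / 1} (*≤* (ℤ.+≤+ (s≤s z≤n))))

-- _/_ normalises through gcd, which does not reduce on open terms.
n/1≡mkℚ : ∀ n → ℤ.+ n / 1 ≡ mkℚ (ℤ.+ n) 0 (coprime-sym (1-coprimeTo n))
n/1≡mkℚ n = ℚP.normalize-coprime (coprime-sym (1-coprimeTo n))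

1/n≡mkℚ : ∀ k → ℤ.+ 1 / suc k ≡ mkℚ (ℤ.+ 1) k (1-coprimeTo (suc k))
1/n≡mkℚ k = ℚP.normalize-coprime (1-coprimeTo (suc k))

n×1≡n/1 : ∀ n → n × 1ℚ ≡ ℤ.+ n / 1
n×1≡n/1 zero    = refl
n×1≡n/1 (suc n) = begin-equality
  1ℚ + n × 1ℚ                        ≡⟨ cong (1ℚ +_) (trans (n×1≡n/1 n) (n/1≡mkℚ n)) ⟩
  (ℤ.+ 1 ℤ.+ ℤ.+ n ℤ.* ℤ.+ 1) / 1  ≡⟨ cong (λ z → (ℤ.+ 1 ℤ.+ z) / 1) (ℤP.*-identityʳ (ℤ.+ n)) ⟩
  ℤ.+ suc n / 1                      ∎

n×y≡n/1*y : ∀ n y → n × y ≡ (ℤ.+ n / 1) * y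
n×y≡n/1*y n y = begin-equality
  n × y            ≡⟨ cong (n ×_) (ℚP.*-identityˡ y) ⟨
  n × (1ℚ * y)     ≡⟨ ×-assoc-* n 1ℚ y ⟨
  (n × 1ℚ) * y     ≡⟨ cong (_* y) (n×1≡n/1 n) ⟩
  (ℤ.+ n / 1) * y  ∎

n/1*1/n≡1 : ∀ k → (ℤ.+ suc k / 1) * (ℤ.+ 1 / suc k) ≡ 1ℚ
n/1*1/n≡1 k = trans (cong₂ _*_ (n/1≡mkℚ (suc k)) (1/n≡mkℚ k))
                    (ℚP.*-inverseʳ (mkℚ (ℤ.+ suc k) 0 (coprime-sym (1-coprimeTo (suc k)))))

0≤1/n : ∀ k → 0ℚ ℚ.≤ ℤ.+ 1 / suc k
0≤1/n k = ℚP.nonNegative⁻¹ _ {{ℚP.normalize-nonNeg 1 (suc k)}}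

1/n≤1 : ∀ k → ℤ.+ 1 / suc k ℚ.≤ 1ℚ
1/n≤1 k = subst (ℚ._≤ 1ℚ) (sym (1/n≡mkℚ k)) (*≤* (ℤ.+≤+ (s≤s z≤n)))

kL+x≤ka⇒L+x≤greedyBound*a : ∀ k {L x a} → suc k × L + x ℚ.≤ suc k × a → x ℚ.≤ a →
                            L + x ℚ.≤ greedyBound (suc (suc k)) * a
kL+x≤ka⇒L+x≤greedyBound*a k {L} {x} {a} kL+x≤ka =
  NL+x≤Na⇒L+x≤[2-q]a {ℤ.+ suc k / 1} (n/1*1/n≡1 k) (0≤1/n k) (1/n≤1 k)
    (subst₂ (λ u v → u + x ℚ.≤ v) (n×y≡n/1*y (suc k) L) (n×y≡n/1*y (suc k) a) kL+x≤ka)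

0≤greedyBound : ∀ k → 0ℚ ℚ.≤ greedyBound (suc (suc k))
0≤greedyBound k = 0≤2-q {ℤ.+ suc k / 1} (n/1*1/n≡1 k) (0≤1/n k) (1/n≤1 k)

module _ {n : ℕ} (G s : Schedule (suc (suc n))) {i : Fin (suc (suc n))}
         (x : ℚ) (κ : Fin (suc (suc n)))
         (same-sizes : sizes G ≡ sizes s) (s≥0 : All (0ℚ ℚ.≤_) (sizes s))
         (least : ∀ j → load G i ℚ.≤ load G j) (s≤G : makespan s ℚ.≤ makespan G) where

  least-load-averaging : suc n × load G i + x ℚ.≤ suc n × makespan ((x , κ) ∷ s)
  least-load-averaging = +-cancelˡ-≤ M (begin
    M + (suc n × L + x)           ≡⟨ ℚP.+-assoc M _ x ⟨
    (M + suc n × L) + x           ≤⟨ ℚP.+-monoˡ-≤ x (f[i]+n×b≤sum (load G) j* least) ⟩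
    sum (load G) + x              ≡⟨ ℚP.+-comm _ x ⟩
    x + sum (load G)              ≡⟨ cong (x +_) (sum-load-cong G s same-sizes) ⟩
    x + sum (load s)              ≡⟨ sum-load-∷ x κ s ⟨
    sum (load s′)                 ≤⟨ sum≤f[i]+n×b (load s′) j₀ (load≤makespan s′) ⟩
    load s′ j₀ + suc n × a        ≤⟨ ℚP.+-monoˡ-≤ _ load[j₀]≤M ⟩
    M + suc n × a                 ∎)
    where
    L a M : ℚ
    L = load G i
    s′ : Schedule (suc (suc n))
    s′ = (x , κ) ∷ s
    a = makespan s′
    G≥0 : ∀ j → 0ℚ ℚ.≤ load G j
    G≥0 = 0≤load G (subst (All _) (sym same-sizes) s≥0)
    attained : ∃[ j ] makespan G ℚ.≤ load G j
    attained = makespan-attained G G≥0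
    j* j₀ : Fin (suc (suc n))
    j* = proj₁ attained
    M = load G j*
    j₀ = punchIn κ zero
    load[j₀]≤M : load s′ j₀ ℚ.≤ M
    load[j₀]≤M = begin
      load s′ j₀   ≡⟨ load-there x s (punchInᵢ≢i κ zero ∘ sym) ⟩
      load s j₀    ≤⟨ load≤makespan s j₀ ⟩
      makespan s   ≤⟨ s≤G ⟩
      makespan G   ≤⟨ proj₂ attained ⟩
      M            ∎

  least-load-bound : load G i + x ℚ.≤ greedyBound (suc (suc n)) * makespan ((x , κ) ∷ s)
  least-load-bound =
    kL+x≤ka⇒L+x≤greedyBound*a n {load G i} {x} least-load-averaging
      (size≤makespan-∷ x κ s (0≤load s s≥0 κ))

take-⊓ : ∀ {A : Set} k (xs ys : List A) → take k xs ≡ take (k ⊓ length xs) (xs ++ ys)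
take-⊓ zero    xs       ys = refl
take-⊓ (suc k) []       ys = refl
take-⊓ (suc k) (x ∷ xs) ys = cong (x ∷_) (take-⊓ k xs ys)

length-∷ʳ : ∀ {A : Set} (xs : List A) x → length (xs ∷ʳ x) ≡ suc (length xs)
length-∷ʳ xs x = trans (length-++-sucʳ xs x []) (cong suc (cong length (++-identityʳ xs)))

zip-∷ʳ : ∀ {A B : Set} (xs : List A) (ys : List B) x y → length xs ≡ length ys →
         zip (xs ∷ʳ x) (ys ∷ʳ y) ≡ zip xs ys ∷ʳ (x , y)
zip-∷ʳ []       []       x y _   = refl
zip-∷ʳ (a ∷ xs) (b ∷ ys) x y len = cong ((a , b) ∷_) (zip-∷ʳ xs ys x y (ℕP.suc-injective len))

sizes-zip : ∀ {m} {I : List ℚ} {σ : List (Fin m)} → length I ≡ length σ → sizes (zip I σ) ≡ I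
sizes-zip {I = []}    {[]}    _   = refl
sizes-zip {I = x ∷ I} {_ ∷ σ} len = cong (x ∷_) (sizes-zip (ℕP.suc-injective len))

makespan-assign-∷ʳ : ∀ {m} (I : List ℚ) (σ : List (Fin m)) x κ → length I ≡ length σ →
                     makespan (assign (I ∷ʳ x) (σ ∷ʳ κ)) ≡ makespan ((x , κ) ∷ assign I σ)
makespan-assign-∷ʳ I σ x κ len =
  trans (cong makespan (zip-∷ʳ I σ x κ len)) (makespan-∷ʳ (assign I σ) (x , κ))

module _ {m : ℕ} (A : OnlineAlg m) where

  sizes-runFrom : ∀ hist I → sizes (runFrom A hist I) ≡ I
  sizes-runFrom hist []      = refl
  sizes-runFrom hist (x ∷ I) = cong (x ∷_) (sizes-runFrom (hist ++ [ x ]) I)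

  runFrom-∷ʳ : ∀ hist I x → runFrom A hist (I ∷ʳ x) ≡ runFrom A hist I ∷ʳ (x , A (hist ++ I) x)
  runFrom-∷ʳ hist []      x = cong (λ h → [ (x , A h x) ]) (sym (++-identityʳ hist))
  runFrom-∷ʳ hist (y ∷ I) x = cong ((y , A hist y) ∷_) (trans (runFrom-∷ʳ (hist ++ [ y ]) I x)
    (cong (λ h → runFrom A (hist ++ [ y ]) I ∷ʳ (x , A h x)) (++-assoc hist [ y ] I)))

  cost-∷ʳ : ∀ I x → cost A (I ∷ʳ x) ≡ makespan ((x , A I x) ∷ run A I)
  cost-∷ʳ I x = trans (cong makespan (runFrom-∷ʳ [] I x)) (makespan-∷ʳ (run A I) (x , A I x))

  RespectsPrefixes-∷ʳ⁻ : ∀ {I σ x κ} → length I ≡ length σ →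
                         RespectsPrefixes A (I ∷ʳ x) (σ ∷ʳ κ) → RespectsPrefixes A I σ
  RespectsPrefixes-∷ʳ⁻ {I} {σ} {x} {κ} len respects k =
    subst₂ (λ J τ → makespan (assign J τ) ℚ.≤ cost A J) (sym takeI) (sym takeσ)
      (respects (k ⊓ length I))
    where
    takeI : take k I ≡ take (k ⊓ length I) (I ∷ʳ x)
    takeI = take-⊓ k I [ x ]
    takeσ : take k σ ≡ take (k ⊓ length I) (σ ∷ʳ κ)
    takeσ = trans (take-⊓ k σ [ κ ]) (cong (λ l → take (k ⊓ l) (σ ∷ʳ κ)) (sym len))

  RespectsPrefixes⇒makespan≤cost : ∀ {I σ} → length I ≡ length σ →
                                   RespectsPrefixes A I σ → makespan (assign I σ) ℚ.≤ cost A I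
  RespectsPrefixes⇒makespan≤cost {I} {σ} len respects =
    subst₂ (λ J τ → makespan (assign J τ) ℚ.≤ cost A J)
      (take-all (length I) I ℕP.≤-refl) (take-all (length I) σ (ℕP.≤-reflexive (sym len)))
      (respects (length I))

greedy-bounded : ∀ {k} {A : OnlineAlg (suc (suc k))} → IsGreedy A →
                 ∀ {I} → Reverse I → All (0ℚ ℚ.≤_) I → BoundedBy A (greedyBound (suc (suc k))) I
greedy-bounded {k} {A} greedy [] _ σ _ _ = begin
  cost A []                   ≤⟨ makespan-lub {suc (suc k)} [] ℚP.≤-refl (λ _ → ℚP.≤-refl) ⟩
  0ℚ                          ≡⟨ ℚP.*-zeroʳ c ⟨
  c * 0ℚ                      ≤⟨ ℚP.*-monoˡ-≤-nonNeg c {{ℚ.nonNegative (0≤greedyBound k)}}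
                                                     (0≤makespan (assign [] σ)) ⟩
  c * makespan (assign [] σ)  ∎
  where
  c : ℚ
  c = greedyBound (suc (suc k))
greedy-bounded {k} {A} greedy (I ∶ rI ∶ʳ x) 0≤Ix σ len respects with reverseView σ
... | [] = contradiction (trans len (length-∷ʳ I x)) λ ()
... | σ′ ∶ _ ∶ʳ κ = begin
  cost A (I ∷ʳ x)                           ≡⟨ cost-∷ʳ A I x ⟩
  makespan ((x , A I x) ∷ run A I)          ≤⟨ makespan-∷-≤ (A I x) (run A I) earlier-jobs new-job ⟩
  c * makespan ((x , κ) ∷ s)                ≡⟨ cong (c *_) (makespan-assign-∷ʳ I σ′ x κ len′) ⟨
  c * makespan (assign (I ∷ʳ x) (σ′ ∷ʳ κ))  ∎
  where
  c : ℚ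
  c = greedyBound (suc (suc k))
  s : Schedule (suc (suc k))
  s = assign I σ′
  len′ : length I ≡ length σ′
  len′ = ℕP.suc-injective (trans (sym (length-∷ʳ I x)) (trans (sym len) (length-∷ʳ σ′ κ)))
  respects′ : RespectsPrefixes A I σ′
  respects′ = RespectsPrefixes-∷ʳ⁻ A len′ respects
  0≤I : All (0ℚ ℚ.≤_) I
  0≤I = ++⁻ˡ I 0≤Ix
  0≤x : 0ℚ ℚ.≤ x
  0≤x with ++⁻ʳ I 0≤Ix
  ... | 0≤x ∷ [] = 0≤x
  earlier-jobs : makespan (run A I) ℚ.≤ c * makespan ((x , κ) ∷ s)
  earlier-jobs = ℚP.≤-trans (greedy-bounded greedy rI 0≤I σ′ (sym len′) respects′)
    (ℚP.*-monoˡ-≤-nonNeg c {{ℚ.nonNegative (0≤greedyBound k)}} (makespan≤makespan-∷ κ s 0≤x))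
  new-job : load (run A I) (A I x) + x ℚ.≤ c * makespan ((x , κ) ∷ s)
  new-job = least-load-bound (run A I) s x κ
    (trans (sizes-runFrom A [] I) (sym (sizes-zip len′)))
    (subst (All _) (sym (sizes-zip len′)) 0≤I)
    (greedy I x)
    (RespectsPrefixes⇒makespan≤cost A len′ respects′)

lemma1 : (m : ℕ) → 2 ≤ m → (A : OnlineAlg m) → IsGreedy A →
    (I : List ℚ) → All (λ x → 0ℚ < x) I → BoundedBy A (greedyBound m) I
lemma1 (suc (suc k)) (s≤s (s≤s z≤n)) A greedy I 0<I =
  greedy-bounded greedy (reverseView I) (All.map ℚP.<⇒≤ 0<I)
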